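{- Let $s_1,\dots,s_n$ be positive integers, let $\mathbf{s}=(s_1,\dots,s_n,s_n+1)$ (of length $n+1$), $\mathbf{s}'=(s_1,\dots,s_n)$ (of length $n$), and $(\mathbf{s}',s_n)=(s_1,\dots,s_n,s_n)$ (of length $n+1$). Then $$h^*_{\mathcal{P}_{n+1}^{\mathbf{s}}}(t)=h^*_{\mathcal{P}_{n+1}^{(\mathbf{s}',s_n)}}(t)+t\cdot h^*_{\mathcal{P}_n^{\mathbf{s}'}}(t).$$
   Context: For a sequence of positive integers $\mathbf{s}=(s_1,\dots,s_n)$, $\mathcal{P}_n^{\mathbf{s}}=\{\mathbf{x}\in\mathbb{R}^n : 0\le x_1/s_1\le\dots\le x_n/s_n\le1\}$. For a $d$-dimensional lattice polytope $P$ with Ehrhart polynomial $\mathcal{L}_P(t)=|tP\cap\mathbb{Z}^n|$, its $h^*$-polynomial $h^*_P(z)$ is the polynomial of degree at most $d$ with $\sum_{t\ge0}\mathcal{L}_P(t)z^t=h^*_P(z)/(1-z)^{d+1}$. -}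

module Defs where

open import Data.Unit using (⊤)
open import Data.Bool using (Bool; true; false; _∧_)
open import Data.Nat as ℕ using (ℕ; zero; suc)
open import Data.Nat.Combinatorics using (_C_)
open import Data.Integer as ℤ using (ℤ; +_; _≤ᵇ_)
open import Data.Product using (_×_; _,_)
open import Data.List as L using (List; []; _∷_; _++_; length; filterᵇ; concatMap; upTo)
open import Data.Vec as V using (Vec; []; _∷_)

-- A rational number a/b (b a positive natural) as a pair (a , b).
-- Comparison a/b ≤ c/d with b,d > 0 is a*d ≤ c*b.
_≤Q_ : ℤ × ℕ → ℤ × ℕ → Bool
(a , b) ≤Q (c , d) = (a ℤ.* + d) ≤ᵇ (c ℤ.* + b)

chainᵇ : List (ℤ × ℕ) → Bool
chainᵇ (p ∷ q ∷ r) = (p ≤Q q) ∧ chainᵇ (q ∷ r)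
chainᵇ _ = true

ratios : ∀ {n} → Vec ℤ n → Vec ℕ n → List (ℤ × ℕ)
ratios [] [] = []
ratios (x ∷ xs) (s ∷ ss) = (x , s) ∷ ratios xs ss

-- x ∈ t · P_n^s  ⇔  0 ≤ x_1/s_1 ≤ ... ≤ x_n/s_n ≤ t
inDilateᵇ : ∀ {n} → Vec ℕ n → ℕ → Vec ℤ n → Bool
inDilateᵇ s t x = chainᵇ (((+ 0) , 1) ∷ (ratios x s ++ ((+ t , 1) ∷ [])))

box : (n : ℕ) → ℕ → List (Vec ℤ n)
box zero B = [] ∷ []
box (suc n) B =
  concatMap (λ v → L.map (λ k → (+ k ℤ.- + B) ∷ v) (upTo (suc (2 ℕ.* B)))) (box n B)

sumℕ : ∀ {n} → Vec ℕ n → ℕ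
sumℕ [] = 0
sumℕ (x ∷ xs) = x ℕ.+ sumℕ xs

-- Every point of tP lies in the box [-B,B]^n with B = t * (s_1+...+s_n),
-- since 0 ≤ x_i ≤ t*s_i; so counting inside this box counts all of tP ∩ ℤ^n.
ehrhart : ∀ {n} → Vec ℕ n → ℕ → ℕ
ehrhart {n} s t = length (filterᵇ (inDilateᵇ s t) (box n (t ℕ.* sumℕ s)))

Σ≤ : ℕ → (ℕ → ℤ) → ℤ
Σ≤ zero f = f 0
Σ≤ (suc k) f = Σ≤ k f ℤ.+ f (suc k)

sign : ℕ → ℤ
sign zero = + 1
sign (suc j) = ℤ.- sign j

-- coefficient of z^k in (1-z)^(d+1) * Σ_t L(t) z^t
hstarCoeffGen : ℕ → (ℕ → ℕ) → ℕ → ℤ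
hstarCoeffGen d L k = Σ≤ k (λ j → sign j ℤ.* + ((suc d) C j) ℤ.* + L (k ℕ.∸ j))

-- h^*-polynomial of P_n^s (full-dimensional, d = n for positive s),
-- given by its coefficient sequence: h^*(z) = (1-z)^(n+1) Σ_t L(t) z^t.
hstar : ∀ {n} → Vec ℕ n → ℕ → ℤ
hstar {n} s = hstarCoeffGen n (ehrhart s)

timesZ : (ℕ → ℤ) → ℕ → ℤ
timesZ f zero = + 0
timesZ f (suc k) = f k

Positive : ∀ {n} → Vec ℕ n → Set
Positive [] = ⊤
Positive (x ∷ xs) = (0 ℕ.< x) × Positive xs

{-# OPTIONS --safe #-}
module Submission where

-- Count the lattice points of tP coordinate by coordinate. Passing from (s′, sₙ) to (s′, sₙ + 1)
-- only changes the range of the last coordinate y: given xₙ, there are #{u < t : xₙ/sₙ ≤ u} more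
-- y with xₙ/sₙ ≤ y/(sₙ+1) ≤ t than with xₙ/sₙ ≤ y/sₙ ≤ t. Summing over x₁, …, xₙ gives
-- L_s(t) = L_(s′,sₙ)(t) + Σ_{u<t} L_s′(u). The generating series of these partial sums is
-- z/(1-z) · Σ L_s′(u) zᵘ, so after multiplying by (1-z)^(n+2) the second summand becomes z · h*_s′(z).

open import Defs
open import Data.Bool using (Bool; true; false; if_then_else_; _∧_)
open import Data.Bool.Properties using (∧-identityʳ; if-cong; if-cong-then; if-eta)
open import Data.Nat
  using (ℕ; zero; suc; _+_; _*_; _∸_; _≤_; _<_; _≤ᵇ_; z≤n; s≤s; s≤s⁻¹; z<s; s<s; NonZero)
open import Data.Nat.Properties
open import Algebra.Properties.CommutativeSemigroup +-commutativeSemigroup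
  using (interchange; x∙yz≈y∙xz)
open import Data.Nat.Combinatorics using (_C_; nCk+nC[k+1]≡[n+1]C[k+1])
open import Data.Integer as ℤ using (ℤ; -_; _-_) renaming (_+_ to _+ℤ_; _*_ to _*ℤ_)
import Data.Integer.Properties as ℤP
open import Data.Integer.Tactic.RingSolver using (solve-∀)
open import Data.List
  using (List; []; _∷_; _++_; length; filterᵇ; map; concatMap; applyUpTo; upTo)
open import Data.List.Properties using (length-++; filter-++; map-applyUpTo)
open import Data.Product using (_×_; _,_)
open import Data.Vec using (Vec; []; _∷_; last; _∷ʳ_)
open import Function using (_∘_; _⇔_; Equivalence; mk⇔)
open import Relation.Binary.PropositionalEquality
open import Relation.Nullary using (T?)
open import Relation.Nullary.Reflects using (det; fromEquivalence; ofʸ; ofⁿ)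

∑< : ℕ → (ℕ → ℕ) → ℕ
∑< zero    f = 0
∑< (suc n) f = f 0 + ∑< n (f ∘ suc)

∑<-cong : ∀ n {f g : ℕ → ℕ} → (∀ i → i < n → f i ≡ g i) → ∑< n f ≡ ∑< n g
∑<-cong zero    eq = refl
∑<-cong (suc n) eq = cong₂ _+_ (eq 0 z<s) (∑<-cong n (λ i i<n → eq (suc i) (s<s i<n)))

∑<-const : ∀ n c → ∑< n (λ _ → c) ≡ n * c
∑<-const zero    c = refl
∑<-const (suc n) c = cong (c +_) (∑<-const n c)

∑<-zero : ∀ n {f : ℕ → ℕ} → (∀ i → i < n → f i ≡ 0) → ∑< n f ≡ 0
∑<-zero n eq = trans (∑<-cong n eq) (trans (∑<-const n 0) (*-zeroʳ n))

∑<-ones : ∀ n {f : ℕ → ℕ} → (∀ i → i < n → f i ≡ 1) → ∑< n f ≡ n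
∑<-ones n eq = trans (∑<-cong n eq) (trans (∑<-const n 1) (*-identityʳ n))

∑<-sucʳ : ∀ n (f : ℕ → ℕ) → ∑< (suc n) f ≡ ∑< n f + f n
∑<-sucʳ zero    f = +-comm (f 0) 0
∑<-sucʳ (suc n) f = trans (cong (f 0 +_) (∑<-sucʳ n (f ∘ suc))) (sym (+-assoc (f 0) _ _))

∑<-distrib-+ : ∀ n (f g : ℕ → ℕ) → ∑< n (λ i → f i + g i) ≡ ∑< n f + ∑< n g
∑<-distrib-+ zero    f g = refl
∑<-distrib-+ (suc n) f g =
  trans (cong (f 0 + g 0 +_) (∑<-distrib-+ n (f ∘ suc) (g ∘ suc))) (interchange (f 0) (g 0) _ _)

∑<-split : ∀ m n (f : ℕ → ℕ) → ∑< (m + n) f ≡ ∑< m f + ∑< n (λ i → f (m + i))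
∑<-split zero    n f = refl
∑<-split (suc m) n f = trans (cong (f 0 +_) (∑<-split m n (f ∘ suc))) (sym (+-assoc (f 0) _ _))

∑<-skipZeros : ∀ m n {f : ℕ → ℕ} → (∀ i → i < m → f i ≡ 0) →
  ∑< (m + n) f ≡ ∑< n (λ i → f (m + i))
∑<-skipZeros m n {f} eq = trans (∑<-split m n f) (cong (_+ ∑< n (λ i → f (m + i))) (∑<-zero m eq))

∑<-extend : ∀ {m n} (f : ℕ → ℕ) → m ≤ n → (∀ i → m ≤ i → f i ≡ 0) → ∑< m f ≡ ∑< n f
∑<-extend {m} {n} f m≤n eq = begin
  ∑< m f                                 ≡⟨ +-identityʳ _ ⟨
  ∑< m f + 0                             ≡⟨ cong (∑< m f +_) tailZero ⟨
  ∑< m f + ∑< (n ∸ m) (λ i → f (m + i)) ≡⟨ ∑<-split m (n ∸ m) f ⟨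
  ∑< (m + (n ∸ m)) f                     ≡⟨ cong (λ k → ∑< k f) (m+[n∸m]≡n m≤n) ⟩
  ∑< n f                                 ∎
  where
  open ≡-Reasoning
  tailZero : ∑< (n ∸ m) (λ i → f (m + i)) ≡ 0
  tailZero = ∑<-zero (n ∸ m) (λ i _ → eq (m + i) (m≤m+n m i))

∑<-comm : ∀ m n (f : ℕ → ℕ → ℕ) → ∑< m (λ i → ∑< n (f i)) ≡ ∑< n (λ j → ∑< m (λ i → f i j))
∑<-comm zero    n f = sym (∑<-zero n (λ _ _ → refl))
∑<-comm (suc m) n f =
  trans (cong (∑< n (f 0) +_) (∑<-comm m n (f ∘ suc))) (sym (∑<-distrib-+ n (f 0) _))

∑<-if : ∀ n b (f : ℕ → ℕ) → ∑< n (λ i → if b then f i else 0) ≡ (if b then ∑< n f else 0)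
∑<-if n true  f = refl
∑<-if n false f = ∑<-zero n (λ _ _ → refl)

if-distrib-+ : ∀ b (m n : ℕ) →
  (if b then m + n else 0) ≡ (if b then m else 0) + (if b then n else 0)
if-distrib-+ true  m n = refl
if-distrib-+ false m n = refl

≤ᵇ-true : ∀ {m n} → m ≤ n → (m ≤ᵇ n) ≡ true
≤ᵇ-true {m} {n} m≤n = det (≤ᵇ-reflects-≤ m n) (ofʸ m≤n)

≤ᵇ-false : ∀ {m n} → n < m → (m ≤ᵇ n) ≡ false
≤ᵇ-false {m} {n} n<m = det (≤ᵇ-reflects-≤ m n) (ofⁿ (<⇒≱ n<m))

≤ᵇ-cong : ∀ {m n p q} → m ≤ n ⇔ p ≤ q → (m ≤ᵇ n) ≡ (p ≤ᵇ q)
≤ᵇ-cong {m} {n} {p} {q} iff =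
  det (≤ᵇ-reflects-≤ m n) (fromEquivalence (from ∘ ≤ᵇ⇒≤ p q) (≤⇒≤ᵇ ∘ to))
  where open Equivalence iff

Σ≤-cong : ∀ k {f g : ℕ → ℤ} → (∀ j → j ≤ k → f j ≡ g j) → Σ≤ k f ≡ Σ≤ k g
Σ≤-cong zero    eq = eq 0 z≤n
Σ≤-cong (suc k) eq = cong₂ _+ℤ_ (Σ≤-cong k (λ j j≤k → eq j (m≤n⇒m≤1+n j≤k))) (eq (suc k) ≤-refl)

Σ≤-distrib-+ : ∀ k (f g : ℕ → ℤ) → Σ≤ k (λ j → f j +ℤ g j) ≡ Σ≤ k f +ℤ Σ≤ k g
Σ≤-distrib-+ zero    f g = refl
Σ≤-distrib-+ (suc k) f g =
  trans (cong (_+ℤ (f (suc k) +ℤ g (suc k))) (Σ≤-distrib-+ k f g))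
        (regroup (Σ≤ k f) (Σ≤ k g) (f (suc k)) (g (suc k)))
  where
  regroup : ∀ a b c d → (a +ℤ b) +ℤ (c +ℤ d) ≡ (a +ℤ c) +ℤ (b +ℤ d)
  regroup = solve-∀

Σ≤-distrib-minus : ∀ k (f g : ℕ → ℤ) → Σ≤ k (λ j → f j - g j) ≡ Σ≤ k f - Σ≤ k g
Σ≤-distrib-minus zero    f g = refl
Σ≤-distrib-minus (suc k) f g =
  trans (cong (_+ℤ (f (suc k) - g (suc k))) (Σ≤-distrib-minus k f g))
        (regroup (Σ≤ k f) (Σ≤ k g) (f (suc k)) (g (suc k)))
  where
  regroup : ∀ a b c d → (a - b) +ℤ (c - d) ≡ (a +ℤ c) - (b +ℤ d)
  regroup = solve-∀

Σ≤-sucˡ : ∀ k (f : ℕ → ℤ) → Σ≤ (suc k) f ≡ f 0 +ℤ Σ≤ k (f ∘ suc)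
Σ≤-sucˡ zero    f = refl
Σ≤-sucˡ (suc k) f = trans (cong (_+ℤ f (suc (suc k))) (Σ≤-sucˡ k f)) (ℤP.+-assoc (f 0) _ _)

signedBinom : ℕ → ℕ → ℤ
signedBinom d j = sign j *ℤ ℤ.+ (suc d C j)

signedBinom-suc : ∀ d j → signedBinom (suc d) (suc j) ≡ signedBinom d (suc j) - signedBinom d j
signedBinom-suc d j = begin
  - sign j *ℤ ℤ.+ (suc (suc d) C suc j)
    ≡⟨ cong (λ n → - sign j *ℤ ℤ.+ n) (nCk+nC[k+1]≡[n+1]C[k+1] (suc d) j) ⟨
  - sign j *ℤ ℤ.+ (suc d C j + suc d C suc j)
    ≡⟨ cong (- sign j *ℤ_) (ℤP.pos-+ (suc d C j) (suc d C suc j)) ⟩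
  - sign j *ℤ (ℤ.+ (suc d C j) +ℤ ℤ.+ (suc d C suc j))
    ≡⟨ expand (sign j) (ℤ.+ (suc d C j)) (ℤ.+ (suc d C suc j)) ⟩
  - sign j *ℤ ℤ.+ (suc d C suc j) - sign j *ℤ ℤ.+ (suc d C j) ∎
  where
  open ≡-Reasoning
  expand : ∀ σ p q → - σ *ℤ (p +ℤ q) ≡ - σ *ℤ q - σ *ℤ p
  expand = solve-∀

hstarCoeffGen-cong : ∀ d {L M : ℕ → ℕ} → (∀ t → L t ≡ M t) → ∀ k →
  hstarCoeffGen d L k ≡ hstarCoeffGen d M k
hstarCoeffGen-cong d eq k = Σ≤-cong k (λ j _ → cong (λ n → signedBinom d j *ℤ ℤ.+ n) (eq (k ∸ j)))

hstarCoeffGen-+ : ∀ d (L M : ℕ → ℕ) k →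
  hstarCoeffGen d (λ t → L t + M t) k ≡ hstarCoeffGen d L k +ℤ hstarCoeffGen d M k
hstarCoeffGen-+ d L M k = trans (Σ≤-cong k distrib) (Σ≤-distrib-+ k _ _)
  where
  distrib : ∀ j → j ≤ k → signedBinom d j *ℤ ℤ.+ (L (k ∸ j) + M (k ∸ j))
                        ≡ signedBinom d j *ℤ ℤ.+ L (k ∸ j) +ℤ signedBinom d j *ℤ ℤ.+ M (k ∸ j)
  distrib j _ = trans (cong (signedBinom d j *ℤ_) (ℤP.pos-+ (L (k ∸ j)) (M (k ∸ j))))
                      (ℤP.*-distribˡ-+ (signedBinom d j) _ _)

hstarCoeffGen-suc : ∀ d (L : ℕ → ℕ) k →
  hstarCoeffGen (suc d) L (suc k) ≡ hstarCoeffGen d L (suc k) - hstarCoeffGen d L k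
hstarCoeffGen-suc d L k = begin
  hstarCoeffGen (suc d) L (suc k)
    ≡⟨ Σ≤-sucˡ k (λ j → signedBinom (suc d) j *ℤ ℤ.+ L (suc k ∸ j)) ⟩
  head +ℤ Σ≤ k (λ j → signedBinom (suc d) (suc j) *ℤ X j)
    ≡⟨ cong (head +ℤ_) (Σ≤-cong k (λ j _ → pascal j)) ⟩
  head +ℤ Σ≤ k (λ j → signedBinom d (suc j) *ℤ X j - signedBinom d j *ℤ X j)
    ≡⟨ cong (head +ℤ_) (Σ≤-distrib-minus k _ _) ⟩
  head +ℤ (Σ≤ k (λ j → signedBinom d (suc j) *ℤ X j) - hstarCoeffGen d L k)
    ≡⟨ ℤP.+-assoc head _ _ ⟨
  (head +ℤ Σ≤ k (λ j → signedBinom d (suc j) *ℤ X j)) - hstarCoeffGen d L k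
    ≡⟨ cong (_- hstarCoeffGen d L k) (Σ≤-sucˡ k (λ j → signedBinom d j *ℤ ℤ.+ L (suc k ∸ j))) ⟨
  hstarCoeffGen d L (suc k) - hstarCoeffGen d L k ∎
  where
  open ≡-Reasoning
  X : ℕ → ℤ
  X j = ℤ.+ L (k ∸ j)
  -- signedBinom (suc d) 0 and signedBinom d 0 both reduce to 1, so the first step is definitional.
  head : ℤ
  head = signedBinom d 0 *ℤ ℤ.+ L (suc k)
  pascal : ∀ j → signedBinom (suc d) (suc j) *ℤ X j
               ≡ signedBinom d (suc j) *ℤ X j - signedBinom d j *ℤ X j
  pascal j = trans (cong (_*ℤ X j) (signedBinom-suc d j))
                   (distrib (signedBinom d (suc j)) (signedBinom d j) (X j))
    where
    distrib : ∀ b c x → (b - c) *ℤ x ≡ b *ℤ x - c *ℤ x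
    distrib = solve-∀

hstarCoeffGen-partialSums-suc : ∀ d (L : ℕ → ℕ) k →
  hstarCoeffGen d (λ t → ∑< t L) (suc k) ≡ hstarCoeffGen d (λ t → ∑< t L) k +ℤ hstarCoeffGen d L k
hstarCoeffGen-partialSums-suc d L k = begin
  Σ≤ k (λ j → c j *ℤ ℤ.+ ∑< (suc k ∸ j) L) +ℤ c (suc k) *ℤ ℤ.+ ∑< (k ∸ k) L
    ≡⟨ cong₂ _+ℤ_ (Σ≤-cong k split) lastTerm ⟩
  Σ≤ k (λ j → c j *ℤ ℤ.+ ∑< (k ∸ j) L +ℤ c j *ℤ ℤ.+ L (k ∸ j)) +ℤ ℤ.+ 0
    ≡⟨ ℤP.+-identityʳ _ ⟩
  Σ≤ k (λ j → c j *ℤ ℤ.+ ∑< (k ∸ j) L +ℤ c j *ℤ ℤ.+ L (k ∸ j))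
    ≡⟨ Σ≤-distrib-+ k _ _ ⟩
  hstarCoeffGen d (λ t → ∑< t L) k +ℤ hstarCoeffGen d L k ∎
  where
  open ≡-Reasoning
  c : ℕ → ℤ
  c = signedBinom d
  split : ∀ j → j ≤ k → c j *ℤ ℤ.+ ∑< (suc k ∸ j) L ≡ c j *ℤ ℤ.+ ∑< (k ∸ j) L +ℤ c j *ℤ ℤ.+ L (k ∸ j)
  split j j≤k = begin
    c j *ℤ ℤ.+ ∑< (suc k ∸ j) L             ≡⟨ cong (λ n → c j *ℤ ℤ.+ ∑< n L) (+-∸-assoc 1 j≤k) ⟩
    c j *ℤ ℤ.+ ∑< (suc (k ∸ j)) L           ≡⟨ cong (λ n → c j *ℤ ℤ.+ n) (∑<-sucʳ (k ∸ j) L) ⟩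
    c j *ℤ ℤ.+ (∑< (k ∸ j) L + L (k ∸ j))   ≡⟨ cong (c j *ℤ_) (ℤP.pos-+ (∑< (k ∸ j) L) (L (k ∸ j))) ⟩
    c j *ℤ (ℤ.+ ∑< (k ∸ j) L +ℤ ℤ.+ L (k ∸ j)) ≡⟨ ℤP.*-distribˡ-+ (c j) _ _ ⟩
    c j *ℤ ℤ.+ ∑< (k ∸ j) L +ℤ c j *ℤ ℤ.+ L (k ∸ j) ∎
  lastTerm : c (suc k) *ℤ ℤ.+ ∑< (k ∸ k) L ≡ ℤ.+ 0
  lastTerm = trans (cong (λ n → c (suc k) *ℤ ℤ.+ ∑< n L) (n∸n≡0 k)) (ℤP.*-zeroʳ (c (suc k)))

hstarCoeffGen-partialSums : ∀ d (L : ℕ → ℕ) k →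
  hstarCoeffGen (suc d) (λ t → ∑< t L) k ≡ timesZ (hstarCoeffGen d L) k
hstarCoeffGen-partialSums d L zero    = ℤP.*-zeroʳ (signedBinom (suc d) 0)
hstarCoeffGen-partialSums d L (suc k) = begin
  hstarCoeffGen (suc d) P (suc k)
    ≡⟨ hstarCoeffGen-suc d P k ⟩
  hstarCoeffGen d P (suc k) - hstarCoeffGen d P k
    ≡⟨ cong (_- hstarCoeffGen d P k) (hstarCoeffGen-partialSums-suc d L k) ⟩
  hstarCoeffGen d P k +ℤ hstarCoeffGen d L k - hstarCoeffGen d P k
    ≡⟨ cancel (hstarCoeffGen d P k) (hstarCoeffGen d L k) ⟩
  hstarCoeffGen d L k ∎
  where
  open ≡-Reasoning
  P : ℕ → ℕ
  P t = ∑< t L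
  cancel : ∀ a b → a +ℤ b - a ≡ b
  cancel = solve-∀

-- chainCount a b s t counts the x ∈ ℕⁿ with a/b ≤ x₁/s₁ ≤ ⋯ ≤ xₙ/sₙ ≤ t.
chainCount : ∀ {n} → ℕ → ℕ → Vec ℕ n → ℕ → ℕ
chainCount a b []      t = if a ≤ᵇ t * b then 1 else 0
chainCount a b (c ∷ s) t = ∑< (suc (t * c)) (λ x → if a * c ≤ᵇ x * b then chainCount x c s t else 0)

chainCount-vanish : ∀ {n} (s : Vec ℕ n) → Positive s → ∀ {a b u} → u * b < a → chainCount a b s u ≡ 0
chainCount-vanish []          _       u*b<a = if-cong (≤ᵇ-false u*b<a)
chainCount-vanish (zero  ∷ s) (() , _)
chainCount-vanish (suc c ∷ s) _ {a} {b} {u} u*b<a =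
  ∑<-zero (suc (u * suc c)) {λ y → if a * suc c ≤ᵇ y * b then chainCount y (suc c) s u else 0}
    (λ y y≤ → if-cong (≤ᵇ-false (below (s≤s⁻¹ y≤))))
  where
  below : ∀ {y} → y ≤ u * suc c → y * b < a * suc c
  below {y} y≤ = begin-strict
    y * b           ≤⟨ *-monoˡ-≤ b y≤ ⟩
    u * suc c * b   ≡⟨ *-assoc u (suc c) b ⟩
    u * (suc c * b) ≡⟨ cong (u *_) (*-comm (suc c) b) ⟩
    u * (b * suc c) ≡⟨ *-assoc u b (suc c) ⟨
    u * b * suc c   <⟨ *-monoˡ-< (suc c) u*b<a ⟩
    a * suc c       ∎
    where open ≤-Reasoning

chainCount-[c] : ∀ x c t .{{_ : NonZero c}} → x ≤ t * c →
  chainCount x c (c ∷ []) t ≡ suc (t * c) ∸ x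
chainCount-[c] x c t x≤tc = begin
  ∑< (suc (t * c)) f      ≡⟨ cong (λ n → ∑< n f) (m+[n∸m]≡n x≤1+tc) ⟨
  ∑< (x + R) f            ≡⟨ ∑<-skipZeros x R (λ y y<x → if-cong (≤ᵇ-false (*-monoˡ-< c y<x))) ⟩
  ∑< R (λ v → f (x + v))  ≡⟨ ∑<-ones R one ⟩
  R                       ∎
  where
  open ≡-Reasoning
  f : ℕ → ℕ
  f y = if x * c ≤ᵇ y * c then (if y ≤ᵇ t * c then 1 else 0) else 0
  R : ℕ
  R = suc (t * c) ∸ x
  x≤1+tc : x ≤ suc (t * c)
  x≤1+tc = m≤n⇒m≤1+n x≤tc
  one : ∀ v → v < R → f (x + v) ≡ 1
  one v v<R =
    trans (if-cong (≤ᵇ-true (*-monoˡ-≤ c (m≤m+n x v))))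
          (if-cong (≤ᵇ-true (s≤s⁻¹ (subst (x + v <_) (m+[n∸m]≡n x≤1+tc) (+-monoʳ-< x v<R)))))

m*[o+1]≤[m+n]*o⇔m≤n*o : ∀ m n o → m * (o + 1) ≤ (m + n) * o ⇔ m ≤ n * o
m*[o+1]≤[m+n]*o⇔m≤n*o m n o = mk⇔
  (λ le → +-cancelˡ-≤ (m * o) m (n * o) (subst₂ _≤_ left right le))
  (λ le → subst₂ _≤_ (sym left) (sym right) (+-monoʳ-≤ (m * o) le))
  where
  left : m * (o + 1) ≡ m * o + m
  left = trans (*-distribˡ-+ m o 1) (cong (m * o +_) (*-identityʳ m))
  right : (m + n) * o ≡ m * o + n * o
  right = *-distribʳ-+ o m n

-- y/(c+1) ≥ x/c iff y = x + u with u·c ≥ x; the u < t are the extra points, the others are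
-- as many as in chainCount-[c].
chainCount-[c+1] : ∀ x c t .{{_ : NonZero c}} → x ≤ t * c →
  chainCount x c (c + 1 ∷ []) t ≡ ∑< t (chainCount x c []) + (suc (t * c) ∸ x)
chainCount-[c+1] x c t x≤tc = begin
  ∑< (suc (t * (c + 1))) f
    ≡⟨ cong (λ n → ∑< n f) range ⟩
  ∑< (x + (t + R)) f
    ≡⟨ ∑<-skipZeros x (t + R) (λ y y<x → if-cong (≤ᵇ-false (below y<x))) ⟩
  ∑< (t + R) (λ u → f (x + u))
    ≡⟨ ∑<-cong (t + R) shifted ⟩
  ∑< (t + R) g
    ≡⟨ ∑<-split t R g ⟩
  ∑< t g + ∑< R (λ v → g (t + v))
    ≡⟨ cong (∑< t g +_) (∑<-ones R (λ v _ → if-cong (≤ᵇ-true (above v)))) ⟩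
  ∑< t g + R ∎
  where
  open ≡-Reasoning
  f g : ℕ → ℕ
  f y = if x * (c + 1) ≤ᵇ y * c then (if y ≤ᵇ t * (c + 1) then 1 else 0) else 0
  g = chainCount x c []
  R : ℕ
  R = suc (t * c) ∸ x
  range : suc (t * (c + 1)) ≡ x + (t + R)
  range = begin
    suc (t * (c + 1))  ≡⟨ cong suc (trans (*-distribˡ-+ t c 1) (cong (t * c +_) (*-identityʳ t))) ⟩
    suc (t * c + t)    ≡⟨ cong suc (+-comm (t * c) t) ⟩
    suc (t + t * c)    ≡⟨ +-suc t (t * c) ⟨
    t + suc (t * c)    ≡⟨ cong (t +_) (m+[n∸m]≡n (m≤n⇒m≤1+n x≤tc)) ⟨
    t + (x + R)        ≡⟨ x∙yz≈y∙xz t x R ⟩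
    x + (t + R)        ∎
  below : ∀ {y} → y < x → y * c < x * (c + 1)
  below y<x = <-≤-trans (*-monoˡ-< c y<x) (*-monoʳ-≤ x (m≤m+n c 1))
  inRange : ∀ {u} → u < t + R → x + u ≤ t * (c + 1)
  inRange {u} u< = s≤s⁻¹ (subst (x + u <_) (sym range) (+-monoʳ-< x u<))
  shifted : ∀ u → u < t + R → f (x + u) ≡ g u
  shifted u u< = trans (if-cong (≤ᵇ-cong (m*[o+1]≤[m+n]*o⇔m≤n*o x u c)))
                       (if-cong-then (x ≤ᵇ u * c) (if-cong (≤ᵇ-true (inRange u<))))
  above : ∀ v → x ≤ (t + v) * c
  above v = ≤-trans x≤tc (*-monoˡ-≤ c (m≤m+n t v))

chainCount-[c+1]≡[c]+∑< : ∀ x c t .{{_ : NonZero c}} → x ≤ t * c →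
  chainCount x c (c + 1 ∷ []) t ≡ chainCount x c (c ∷ []) t + ∑< t (chainCount x c [])
chainCount-[c+1]≡[c]+∑< x c t x≤tc = begin
  chainCount x c (c + 1 ∷ []) t  ≡⟨ chainCount-[c+1] x c t x≤tc ⟩
  ∑< t g + (suc (t * c) ∸ x)     ≡⟨ +-comm (∑< t g) _ ⟩
  suc (t * c) ∸ x + ∑< t g       ≡⟨ cong (_+ ∑< t g) (chainCount-[c] x c t x≤tc) ⟨
  chainCount x c (c ∷ []) t + ∑< t g ∎
  where
  open ≡-Reasoning
  g : ℕ → ℕ
  g = chainCount x c []

chainCount-∷-lift : ∀ {n₁ n₂ n₃} a b c t (s₁ : Vec ℕ n₁) (s₂ : Vec ℕ n₂) (s₃ : Vec ℕ n₃) →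
  Positive s₃ →
  (∀ x → x ≤ t * c → chainCount x c s₁ t ≡ chainCount x c s₂ t + ∑< t (chainCount x c s₃)) →
  chainCount a b (c ∷ s₁) t ≡ chainCount a b (c ∷ s₂) t + ∑< t (chainCount a b (c ∷ s₃))
chainCount-∷-lift a b c t s₁ s₂ s₃ pos hyp = begin
  ∑< (suc (t * c)) (λ x → if P x then chainCount x c s₁ t else 0)
    ≡⟨ ∑<-cong (suc (t * c)) (λ x x≤ → trans (if-cong-then (P x) (hyp x (s≤s⁻¹ x≤))) (split x)) ⟩
  ∑< (suc (t * c)) (λ x → onS₂ x + onS₃ x)
    ≡⟨ ∑<-distrib-+ (suc (t * c)) onS₂ onS₃ ⟩
  chainCount a b (c ∷ s₂) t + ∑< (suc (t * c)) onS₃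
    ≡⟨ cong (chainCount a b (c ∷ s₂) t +_) partialSums ⟨
  chainCount a b (c ∷ s₂) t + ∑< t (chainCount a b (c ∷ s₃)) ∎
  where
  open ≡-Reasoning
  P : ℕ → Bool
  P x = a * c ≤ᵇ x * b
  onS₂ onS₃ : ℕ → ℕ
  onS₂ x = if P x then chainCount x c s₂ t else 0
  onS₃ x = if P x then ∑< t (chainCount x c s₃) else 0
  split : ∀ x → (if P x then chainCount x c s₂ t + ∑< t (chainCount x c s₃) else 0) ≡ onS₂ x + onS₃ x
  split x = if-distrib-+ (P x) (chainCount x c s₂ t) (∑< t (chainCount x c s₃))
  term : ℕ → ℕ → ℕ
  term u x = if P x then chainCount x c s₃ u else 0
  partialSums : ∑< t (chainCount a b (c ∷ s₃)) ≡ ∑< (suc (t * c)) onS₃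
  partialSums = begin
    ∑< t (λ u → ∑< (suc (u * c)) (term u))
      ≡⟨ ∑<-cong t (λ u u<t → ∑<-extend (term u) (s≤s (*-monoˡ-≤ c (<⇒≤ u<t)))
           (λ x x> → trans (if-cong-then (P x) (chainCount-vanish s₃ pos x>)) (if-eta (P x)))) ⟩
    ∑< t (λ u → ∑< (suc (t * c)) (term u))
      ≡⟨ ∑<-comm t (suc (t * c)) term ⟩
    ∑< (suc (t * c)) (λ x → ∑< t (λ u → term u x))
      ≡⟨ ∑<-cong (suc (t * c)) (λ x _ → ∑<-if t (P x) (chainCount x c s₃)) ⟩
    ∑< (suc (t * c)) onS₃ ∎

chainCount-bumpLast : ∀ {m} (s : Vec ℕ (suc m)) → Positive s → ∀ a b t →
  chainCount a b (s ∷ʳ (last s + 1)) t ≡ chainCount a b (s ∷ʳ last s) t + ∑< t (chainCount a b s)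
chainCount-bumpLast {zero}  (zero  ∷ []) (() , _)
chainCount-bumpLast {zero}  (suc c ∷ []) _         a b t =
  chainCount-∷-lift a b (suc c) t (suc c + 1 ∷ []) (suc c ∷ []) [] _
    (λ x x≤ → chainCount-[c+1]≡[c]+∑< x (suc c) t x≤)
chainCount-bumpLast {suc m} (c ∷ s)      (_ , pos) a b t =
  chainCount-∷-lift a b c t (s ∷ʳ (last s + 1)) (s ∷ʳ last s) s pos
    (λ x _ → chainCount-bumpLast s pos x c t)

countᵇ : ∀ {A : Set} → (A → Bool) → List A → ℕ
countᵇ p xs = length (filterᵇ p xs)

countᵇ-∷ : ∀ {A : Set} (p : A → Bool) x xs →
  countᵇ p (x ∷ xs) ≡ (if p x then 1 else 0) + countᵇ p xs
countᵇ-∷ p x xs with p x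
... | true  = refl
... | false = refl

countᵇ-++ : ∀ {A : Set} (p : A → Bool) xs ys → countᵇ p (xs ++ ys) ≡ countᵇ p xs + countᵇ p ys
countᵇ-++ p xs ys = trans (cong length (filter-++ (T? ∘ p) xs ys)) (length-++ (filterᵇ p xs))

countᵇ-false : ∀ {A : Set} (xs : List A) → countᵇ (λ _ → false) xs ≡ 0
countᵇ-false []       = refl
countᵇ-false (x ∷ xs) = countᵇ-false xs

countᵇ-∧ : ∀ {A : Set} b (p : A → Bool) xs →
  countᵇ (λ x → b ∧ p x) xs ≡ (if b then countᵇ p xs else 0)
countᵇ-∧ true  p xs = refl
countᵇ-∧ false p xs = countᵇ-false xs

countᵇ-applyUpTo : ∀ {A : Set} (p : A → Bool) (f : ℕ → A) n →
  countᵇ p (applyUpTo f n) ≡ ∑< n (λ i → if p (f i) then 1 else 0)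
countᵇ-applyUpTo p f zero    = refl
countᵇ-applyUpTo p f (suc n) =
  trans (countᵇ-∷ p (f 0) _) (cong ((if p (f 0) then 1 else 0) +_) (countᵇ-applyUpTo p (f ∘ suc) n))

countᵇ-grid : ∀ {A B : Set} (p : A → Bool) (g : ℕ → B → A) n vs →
  countᵇ p (concatMap (λ v → map (λ i → g i v) (upTo n)) vs) ≡ ∑< n (λ i → countᵇ (p ∘ g i) vs)
countᵇ-grid p g n []       = sym (∑<-zero n (λ _ _ → refl))
countᵇ-grid p g n (v ∷ vs) = begin
  countᵇ p (row ++ rest)                       ≡⟨ countᵇ-++ p row rest ⟩
  countᵇ p row + countᵇ p rest                 ≡⟨ cong₂ _+_ rowCount (countᵇ-grid p g n vs) ⟩
  ∑< n hit + ∑< n (λ i → countᵇ (p ∘ g i) vs) ≡⟨ ∑<-distrib-+ n hit _ ⟨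
  ∑< n (λ i → hit i + countᵇ (p ∘ g i) vs)    ≡⟨ ∑<-cong n (λ i _ → countᵇ-∷ (p ∘ g i) v vs) ⟨
  ∑< n (λ i → countᵇ (p ∘ g i) (v ∷ vs))      ∎
  where
  open ≡-Reasoning
  row rest : List _
  row  = map (λ i → g i v) (upTo n)
  rest = concatMap (λ v → map (λ i → g i v) (upTo n)) vs
  hit : ℕ → ℕ
  hit i = if p (g i v) then 1 else 0
  rowCount : countᵇ p row ≡ ∑< n hit
  rowCount = trans (cong (countᵇ p) (map-applyUpTo (λ i → i) (λ i → g i v) n))
                   (countᵇ-applyUpTo p (λ i → g i v) n)

aboveᵇ : ∀ {n} → ℤ × ℕ → Vec ℕ n → ℕ → Vec ℤ n → Bool
aboveᵇ q s t x = chainᵇ (q ∷ (ratios x s ++ (ℤ.+ t , 1) ∷ []))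

≤Q-pos : ∀ a b x c → ((ℤ.+ a , b) ≤Q (ℤ.+ x , c)) ≡ (a * c ≤ᵇ x * b)
≤Q-pos a b x c = cong₂ ℤ._≤ᵇ_ (sym (ℤP.pos-* a c)) (sym (ℤP.pos-* x b))

+m-+n≡-[1+n∸suc[m]] : ∀ {m n} → m < n → ℤ.+ m - ℤ.+ n ≡ ℤ.-[1+ n ∸ suc m ]
+m-+n≡-[1+n∸suc[m]] {m} {n} m<n =
  trans (ℤP.m-n≡m⊖n m n) (trans (ℤP.⊖-< m<n) (cong (λ k → - ℤ.+ k) (+-∸-assoc 1 m<n)))

+[m+n]-+m≡+n : ∀ m n → ℤ.+ (m + n) - ℤ.+ m ≡ ℤ.+ n
+[m+n]-+m≡+n m n =
  trans (ℤP.m-n≡m⊖n (m + n) m) (trans (ℤP.⊖-≥ (m≤m+n m n)) (cong ℤ.+_ (m+n∸m≡n m n)))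

countᵇ-aboveᵇ-box-∷ : ∀ {n} q c (s : Vec ℕ n) t B →
  countᵇ (aboveᵇ q (c ∷ s) t) (box (suc n) B)
    ≡ ∑< (suc (2 * B)) (λ k → if q ≤Q (ℤ.+ k - ℤ.+ B , c)
                               then countᵇ (aboveᵇ (ℤ.+ k - ℤ.+ B , c) s t) (box n B) else 0)
countᵇ-aboveᵇ-box-∷ {n} q c s t B =
  trans (countᵇ-grid (aboveᵇ q (c ∷ s) t) (λ k v → ℤ.+ k - ℤ.+ B ∷ v) (suc (2 * B)) (box n B))
        (∑<-cong (suc (2 * B)) (λ k _ → countᵇ-∧ (q ≤Q (x k , c)) (aboveᵇ (x k , c) s t) (box n B)))
  where
  x : ℕ → ℤ
  x k = ℤ.+ k - ℤ.+ B

-- Box index k is the coordinate k - B; the indices k < B give negative coordinates, which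
-- violate the lower bound a/(1+b) ≥ 0.
countᵇ-aboveᵇ-box : ∀ {n} (s : Vec ℕ n) → Positive s → ∀ {B} a b t → t * sumℕ s ≤ B →
  countᵇ (aboveᵇ (ℤ.+ a , suc b) s t) (box n B) ≡ chainCount a (suc b) s t
countᵇ-aboveᵇ-box [] _ a b t _ = begin
  countᵇ (aboveᵇ (ℤ.+ a , suc b) [] t) ([] ∷ [])
    ≡⟨ countᵇ-∷ (aboveᵇ (ℤ.+ a , suc b) [] t) [] [] ⟩
  (if (ℤ.+ a , suc b) ≤Q (ℤ.+ t , 1) ∧ true then 1 else 0) + 0
    ≡⟨ +-identityʳ _ ⟩
  (if (ℤ.+ a , suc b) ≤Q (ℤ.+ t , 1) ∧ true then 1 else 0)
    ≡⟨ if-cong bound ⟩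
  (if a ≤ᵇ t * suc b then 1 else 0) ∎
  where
  open ≡-Reasoning
  bound : ((ℤ.+ a , suc b) ≤Q (ℤ.+ t , 1) ∧ true) ≡ (a ≤ᵇ t * suc b)
  bound = trans (∧-identityʳ _) (trans (≤Q-pos a (suc b) t 1) (cong (_≤ᵇ t * suc b) (*-identityʳ a)))
countᵇ-aboveᵇ-box (zero  ∷ s) (() , _)
countᵇ-aboveᵇ-box {suc n} (suc c ∷ s) (_ , pos) {B} a b t tΣ≤B = begin
  countᵇ (aboveᵇ (ℤ.+ a , suc b) (suc c ∷ s) t) (box (suc n) B)
    ≡⟨ countᵇ-aboveᵇ-box-∷ _ (suc c) s t B ⟩
  ∑< (suc (2 * B)) f            ≡⟨ cong (λ m → ∑< m f) 1+2B≡B+1+B ⟩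
  ∑< (B + suc B) f              ≡⟨ ∑<-skipZeros B (suc B) (λ k k<B → if-cong (negative k<B)) ⟩
  ∑< (suc B) (λ x → f (B + x))  ≡⟨ ∑<-cong (suc B) (λ x _ → shifted x) ⟩
  ∑< (suc B) g                  ≡⟨ ∑<-extend g (s≤s tc≤B) vanish ⟨
  ∑< (suc (t * suc c)) g        ∎
  where
  open ≡-Reasoning
  1+2B≡B+1+B : suc (2 * B) ≡ B + suc B
  1+2B≡B+1+B = trans (sym (+-suc B (B + 0))) (cong (λ m → B + suc m) (+-identityʳ B))
  tΣ≤B′ : t * sumℕ s ≤ B
  tΣ≤B′ = ≤-trans (*-monoʳ-≤ t (m≤n+m (sumℕ s) (suc c))) tΣ≤B
  tc≤B : t * suc c ≤ B
  tc≤B = ≤-trans (*-monoʳ-≤ t (m≤m+n (suc c) (sumℕ s))) tΣ≤B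
  f g : ℕ → ℕ
  f k = if (ℤ.+ a , suc b) ≤Q (ℤ.+ k - ℤ.+ B , suc c)
          then countᵇ (aboveᵇ (ℤ.+ k - ℤ.+ B , suc c) s t) (box n B) else 0
  g x = if a * suc c ≤ᵇ x * suc b then chainCount x (suc c) s t else 0
  negative : ∀ {k} → k < B → ((ℤ.+ a , suc b) ≤Q (ℤ.+ k - ℤ.+ B , suc c)) ≡ false
  negative {k} k<B =
    trans (cong (λ i → (ℤ.+ a , suc b) ≤Q (i , suc c)) (+m-+n≡-[1+n∸suc[m]] k<B))
          (cong (ℤ._≤ᵇ ℤ.-[1+ B ∸ suc k ] *ℤ ℤ.+ suc b) (sym (ℤP.pos-* a (suc c))))
  shifted : ∀ x → f (B + x) ≡ g x
  shifted x rewrite +[m+n]-+m≡+n B x =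
    trans (if-cong (≤Q-pos a (suc b) x (suc c)))
          (if-cong-then (a * suc c ≤ᵇ x * suc b) (countᵇ-aboveᵇ-box s pos x c t tΣ≤B′))
  vanish : ∀ x → suc (t * suc c) ≤ x → g x ≡ 0
  vanish x tc<x =
    trans (if-cong-then (a * suc c ≤ᵇ x * suc b) (chainCount-vanish s pos tc<x)) (if-eta _)

ehrhart≡chainCount : ∀ {n} (s : Vec ℕ n) → Positive s → ∀ t → ehrhart s t ≡ chainCount 0 1 s t
ehrhart≡chainCount s pos t = countᵇ-aboveᵇ-box s pos 0 0 t ≤-refl

Positive-∷ʳ : ∀ {n} (s : Vec ℕ n) {x} → Positive s → 0 < x → Positive (s ∷ʳ x)
Positive-∷ʳ []      _           0<x = 0<x , _
Positive-∷ʳ (c ∷ s) (0<c , pos) 0<x = 0<c , Positive-∷ʳ s pos 0<x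

Positive-last : ∀ {m} (s : Vec ℕ (suc m)) → Positive s → 0 < last s
Positive-last {zero}  (c ∷ []) (0<c , _) = 0<c
Positive-last {suc m} (c ∷ s)  (_ , pos) = Positive-last s pos

ehrhart-bumpLast : ∀ {m} (s : Vec ℕ (suc m)) → Positive s → ∀ t →
  ehrhart (s ∷ʳ (last s + 1)) t ≡ ehrhart (s ∷ʳ last s) t + ∑< t (ehrhart s)
ehrhart-bumpLast s pos t = begin
  ehrhart (s ∷ʳ (last s + 1)) t
    ≡⟨ ehrhart≡chainCount (s ∷ʳ (last s + 1)) (Positive-∷ʳ s pos (m≤n+m 1 (last s))) t ⟩
  chainCount 0 1 (s ∷ʳ (last s + 1)) t
    ≡⟨ chainCount-bumpLast s pos 0 1 t ⟩
  chainCount 0 1 (s ∷ʳ last s) t + ∑< t (chainCount 0 1 s)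
    ≡⟨ cong₂ _+_ (ehrhart≡chainCount (s ∷ʳ last s) (Positive-∷ʳ s pos (Positive-last s pos)) t)
                 (∑<-cong t (λ u _ → ehrhart≡chainCount s pos u)) ⟨
  ehrhart (s ∷ʳ last s) t + ∑< t (ehrhart s) ∎
  where open ≡-Reasoning

proposition3p1 : (m : ℕ) (s' : Vec ℕ (suc m)) → Positive s' →
    (k : ℕ) →
    hstar (s' ∷ʳ (last s' + 1)) k
      ≡ hstar (s' ∷ʳ last s') k +ℤ timesZ (hstar s') k
proposition3p1 m s' pos k = begin
  hstar (s' ∷ʳ (last s' + 1)) k
    ≡⟨ hstarCoeffGen-cong (2 + m) (ehrhart-bumpLast s' pos) k ⟩
  hstarCoeffGen (2 + m) (λ t → ehrhart (s' ∷ʳ last s') t + ∑< t (ehrhart s')) k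
    ≡⟨ hstarCoeffGen-+ (2 + m) (ehrhart (s' ∷ʳ last s')) (λ t → ∑< t (ehrhart s')) k ⟩
  hstar (s' ∷ʳ last s') k +ℤ hstarCoeffGen (2 + m) (λ t → ∑< t (ehrhart s')) k
    ≡⟨ cong (hstar (s' ∷ʳ last s') k +ℤ_) (hstarCoeffGen-partialSums (suc m) (ehrhart s') k) ⟩
  hstar (s' ∷ʳ last s') k +ℤ timesZ (hstar s') k ∎
  where open ≡-Reasoning
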